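{- Let $\phi,\psi$ be modal formulas such that $\phi\to\psi$ is valid, and fix a type elimination sequence $\mathcal X_0,\dots,\mathcal X_n$ for $\phi,\psi$ whose final quasi-model $\mathcal X_n$ contains no type $\tau$ with $\mathrm{nnf}(\phi)\in\tau_L$ and $\mathrm{nnf}(\neg\psi)\in\tau_R$. If a type $\tau=(\tau_L,\tau_R)$ gets eliminated in this sequence (i.e. $\tau\in\mathcal X_0\setminus\mathcal X_n$), then there is a modal formula $\vartheta_\tau$ such that $\models(\bigwedge\tau_L)\to\vartheta_\tau$, $\models\vartheta_\tau\to\neg(\bigwedge\tau_R)$, and every proposition letter occurring positively (resp. negatively) in $\vartheta_\tau$ occurs positively (resp. negatively) in both $\phi$ and $\psi$.
   Context: Validity $\models$ is truth at all worlds of all Kripke models. $\mathrm{nnf}(\chi)$ is the negation normal form of $\chi$. For $\chi$ in NNF, $\mathrm{SUBF}(\chi)$ is its set of subformulas, except $\mathrm{SUBF}(\neg p)=\{\neg p\}$. $X\subseteq\mathrm{SUBF}(\chi)$ is locally consistent if conjunctions in $X$ have both conjuncts in $X$, disjunctions in $X$ have a disjunct in $X$, $\bot\notin X$, and no $p,\neg p$ both in $X$. L-types are locally consistent subsets of $\mathrm{SUBF}(\mathrm{nnf}(\phi))$, R-types of $\mathrm{SUBF}(\mathrm{nnf}(\neg\psi))$; a type is a pair $(\tau_L,\tau_R)$. A type is overlap-consistent if no letter $p$ has $p$ in one component and $\neg p$ in the other. $\tau\Rightarrow\tau'$ means for $D\in\{L,R\}$, $\Box\chi\in\tau_D$ implies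 $\chi\in\tau'_D$. A quasi-model is a set $\mathcal X$ of types whose members are overlap-consistent and such that for every $\tau\in\mathcal X$, $D\in\{L,R\}$, $\Diamond\chi\in\tau_D$ there is $\tau'\in\mathcal X$ with $\tau\Rightarrow\tau'$ and $\chi\in\tau'_D$. A type elimination sequence is $\mathcal X_0,\dots,\mathcal X_n$ with $\mathcal X_0$ the set of all types, each $\mathcal X_{i+1}$ obtained from $\mathcal X_i$ by removing one type violating one of the two quasi-model conditions relative to $\mathcal X_i$, and $\mathcal X_n$ a quasi-model. Positive/negative occurrences of letters are defined as usual. -}

module Defs where

open import Data.Nat using (ℕ; zero; suc; _<_)
open import Data.Bool using (Bool; true)
open import Data.List using (List; []; _∷_; _++_; foldr)
open import Data.List.Membership.Propositional using (_∈_; _∉_)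
open import Data.List.Relation.Unary.All using (All)
open import Data.Product using (Σ; _×_; _,_; proj₁; proj₂)
open import Data.Sum using (_⊎_)
open import Data.Empty using (⊥)
open import Data.Unit using (⊤)
open import Relation.Nullary using (¬_)
open import Relation.Binary.PropositionalEquality using (_≡_)

data Fm : Set where
  var  : ℕ → Fm
  bot  : Fm
  top  : Fm
  neg  : Fm → Fm
  conj : Fm → Fm → Fm
  disj : Fm → Fm → Fm
  imp  : Fm → Fm → Fm
  box  : Fm → Fm
  dia  : Fm → Fm

-- The metatheory is constructive; to obtain the usual
-- (classical) Kripke semantics every truth value is made ¬¬-stable:
-- letters are Bool-valued, ∨ and ◇ are read via their classical
-- (De Morgan) definitions.  Classically this is the standard semantics.

record Model : Set₁ where
  field
    World : Set
    Acc : World → World → Set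
    Val : ℕ → World → Bool

open Model public

_,_⊩_ : (M : Model) → World M → Fm → Set
M , w ⊩ var p    = Val M p w ≡ true
M , w ⊩ bot      = ⊥
M , w ⊩ top      = ⊤
M , w ⊩ neg a    = ¬ (M , w ⊩ a)
M , w ⊩ conj a b = (M , w ⊩ a) × (M , w ⊩ b)
M , w ⊩ disj a b = ¬ (¬ (M , w ⊩ a) × ¬ (M , w ⊩ b))
M , w ⊩ imp a b  = (M , w ⊩ a) → (M , w ⊩ b)
M , w ⊩ box a    = ∀ v → Acc M w v → M , v ⊩ a
M , w ⊩ dia a    = ¬ (∀ v → Acc M w v → ¬ (M , v ⊩ a))

⊨_ : Fm → Set₁
⊨ a = (M : Model) (w : World M) → M , w ⊩ a

mutual
  nnf : Fm → Fm
  nnf (var p)    = var p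
  nnf bot        = bot
  nnf top        = top
  nnf (neg a)    = nnfNeg a
  nnf (conj a b) = conj (nnf a) (nnf b)
  nnf (disj a b) = disj (nnf a) (nnf b)
  nnf (imp a b)  = disj (nnfNeg a) (nnf b)
  nnf (box a)    = box (nnf a)
  nnf (dia a)    = dia (nnf a)

  nnfNeg : Fm → Fm
  nnfNeg (var p)    = neg (var p)
  nnfNeg bot        = top
  nnfNeg top        = bot
  nnfNeg (neg a)    = nnf a
  nnfNeg (conj a b) = disj (nnfNeg a) (nnfNeg b)
  nnfNeg (disj a b) = conj (nnfNeg a) (nnfNeg b)
  nnfNeg (imp a b)  = conj (nnf a) (nnfNeg b)
  nnfNeg (box a)    = dia (nnfNeg a)
  nnfNeg (dia a)    = box (nnfNeg a)

-- Subformulas of an NNF formula (as a list); SUBF(¬ p) = {¬ p}.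
-- (In NNF, negation only occurs in front of letters.)

subf : Fm → List Fm
subf (var p)    = var p ∷ []
subf bot        = bot ∷ []
subf top        = top ∷ []
subf (neg a)    = neg a ∷ []
subf (conj a b) = conj a b ∷ (subf a ++ subf b)
subf (disj a b) = disj a b ∷ (subf a ++ subf b)
subf (imp a b)  = imp a b ∷ (subf a ++ subf b)
subf (box a)    = box a ∷ subf a
subf (dia a)    = dia a ∷ subf a

record LocCons (χ : Fm) (X : List Fm) : Set where
  field
    sub      : All (_∈ subf χ) X
    conjCl   : ∀ a b → conj a b ∈ X → (a ∈ X) × (b ∈ X)
    disjCl   : ∀ a b → disj a b ∈ X → (a ∈ X) ⊎ (b ∈ X)
    noBot    : bot ∉ X
    noClash  : ∀ p → ¬ ((var p ∈ X) × (neg (var p) ∈ X))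

Ty : Set
Ty = List Fm × List Fm

data Side : Set where
  L R : Side

comp : Side → Ty → List Fm
comp L τ = proj₁ τ
comp R τ = proj₂ τ

IsType : Fm → Fm → Ty → Set
IsType φ ψ τ = LocCons (nnf φ) (proj₁ τ) × LocCons (nnf (neg ψ)) (proj₂ τ)

_≈ᵀ_ : Ty → Ty → Set
σ ≈ᵀ τ = ∀ D a → ((a ∈ comp D σ) → (a ∈ comp D τ)) × ((a ∈ comp D τ) → (a ∈ comp D σ))

OverlapCons : Ty → Set
OverlapCons τ = ∀ p → ¬ ((var p ∈ proj₁ τ) × (neg (var p) ∈ proj₂ τ))
                    × ¬ ((neg (var p) ∈ proj₁ τ) × (var p ∈ proj₂ τ))

_⇒ᵀ_ : Ty → Ty → Set
τ ⇒ᵀ τ' = ∀ D a → box a ∈ comp D τ → a ∈ comp D τ'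

TySet : Set₁
TySet = Ty → Set

DiaWitnessed : TySet → Ty → Set
DiaWitnessed X τ = ∀ D a → dia a ∈ comp D τ →
  Σ Ty (λ τ' → X τ' × (τ ⇒ᵀ τ') × (a ∈ comp D τ'))

QuasiModel : TySet → Set
QuasiModel X = ∀ τ → X τ → OverlapCons τ × DiaWitnessed X τ

Violates : TySet → Ty → Set
Violates X τ = (¬ OverlapCons τ)
  ⊎ Σ Side (λ D → Σ Fm (λ a → (dia a ∈ comp D τ) ×
      ¬ Σ Ty (λ τ' → X τ' × (τ ⇒ᵀ τ') × (a ∈ comp D τ'))))

record ElimSeq (φ ψ : Fm) : Set₁ where
  field
    n     : ℕ
    X     : ℕ → TySet
    start : ∀ σ → (X 0 σ → IsType φ ψ σ) × (IsType φ ψ σ → X 0 σ)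
    step  : ∀ i → i < n → Σ Ty (λ τ → X i τ × Violates (X i) τ ×
              (∀ σ → (X (suc i) σ → X i σ × ¬ (σ ≈ᵀ τ))
                   × (X i σ × ¬ (σ ≈ᵀ τ) → X (suc i) σ)))
    final : QuasiModel (X n)

⋀ : List Fm → Fm
⋀ = foldr conj top

mutual
  data Pos (p : ℕ) : Fm → Set where
    pvar   : Pos p (var p)
    pneg   : ∀ {a} → Neg p a → Pos p (neg a)
    pconjˡ : ∀ {a b} → Pos p a → Pos p (conj a b)
    pconjʳ : ∀ {a b} → Pos p b → Pos p (conj a b)
    pdisjˡ : ∀ {a b} → Pos p a → Pos p (disj a b)
    pdisjʳ : ∀ {a b} → Pos p b → Pos p (disj a b)
    pimpˡ  : ∀ {a b} → Neg p a → Pos p (imp a b)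
    pimpʳ  : ∀ {a b} → Pos p b → Pos p (imp a b)
    pbox   : ∀ {a} → Pos p a → Pos p (box a)
    pdia   : ∀ {a} → Pos p a → Pos p (dia a)

  data Neg (p : ℕ) : Fm → Set where
    nneg   : ∀ {a} → Pos p a → Neg p (neg a)
    nconjˡ : ∀ {a b} → Neg p a → Neg p (conj a b)
    nconjʳ : ∀ {a b} → Neg p b → Neg p (conj a b)
    ndisjˡ : ∀ {a b} → Neg p a → Neg p (disj a b)
    ndisjʳ : ∀ {a b} → Neg p b → Neg p (disj a b)
    nimpˡ  : ∀ {a b} → Pos p a → Neg p (imp a b)
    nimpʳ  : ∀ {a b} → Neg p b → Neg p (imp a b)
    nbox   : ∀ {a} → Neg p a → Neg p (box a)
    ndia   : ∀ {a} → Neg p a → Neg p (dia a)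

-- Types are eliminated one at a time, so by induction along the elimination sequence every
-- eliminated type τ gets an interpolant built from those of the types eliminated before it.
-- If τ is overlap-inconsistent, a literal of τL whose complement lies in τR separates them.
-- If ◇χ ∈ τL has no witness, every type σ with τ ⇒ σ and χ ∈ σL was eliminated earlier, and
--   θτ = ◇ ⋁_{σL} ⋀_{σR} θ(σL,σR)
-- works: the subformulas true at a world form a type, so a successor world of a model of
-- ⋀τL picks out a disjunct, while a successor world of a model of ⋀τR refutes each disjunct.
-- The case ◇χ ∈ τR is the same one with the roles of φ and ¬ψ exchanged.
module Submission where

open import Defs
open import Data.Nat using (ℕ; zero; suc; _≤_; z≤n)
import Data.Nat as ℕ
open import Data.Nat.Properties using (≤-refl; <⇒≤)
open import Data.Bool using (true)
import Data.Bool.Properties as Bool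
open import Data.List using (List; []; _∷_; _++_; map; foldr; concatMap)
open import Data.List.Properties using (∷-injectiveˡ; ≡-dec)
open import Data.List.Membership.Propositional using (_∈_; _∉_; lose; find)
open import Data.List.Membership.Propositional.Properties using (∈-++⁺ˡ; ∈-++⁺ʳ; ∈-++⁻; ∈-map⁺; ∈-map⁻; ∈-concat⁺′)
open import Data.List.Relation.Unary.Any using (here; there; any?)
open import Data.List.Relation.Unary.All using (All; []; _∷_; all?; lookup; tabulate)
open import Data.Product using (Σ; _×_; _,_; proj₁; proj₂; swap)
open import Data.Sum using (_⊎_; inj₁; inj₂)
open import Data.Empty using (⊥; ⊥-elim)
open import Data.Unit using (⊤; tt)
open import Function using (_∘_)
open import Relation.Nullary using (¬_; Dec; yes; no)
open import Relation.Nullary.Decidable using (map′; _×-dec_; _⊎-dec_; _→-dec_; ¬?; ¬¬-excluded-middle)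
open import Relation.Binary.Definitions using (DecidableEquality)
open import Relation.Binary.PropositionalEquality using (_≡_; refl; cong; trans; module ≡-Reasoning)

-- Formulas have decidable equality because their postfix code is decoded by a stack machine.
code : Fm → List ℕ → List ℕ
code (var p)    cs = 0 ∷ p ∷ cs
code bot        cs = 1 ∷ cs
code top        cs = 2 ∷ cs
code (neg a)    cs = code a (3 ∷ cs)
code (conj a b) cs = code a (code b (4 ∷ cs))
code (disj a b) cs = code a (code b (5 ∷ cs))
code (imp a b)  cs = code a (code b (6 ∷ cs))
code (box a)    cs = code a (7 ∷ cs)
code (dia a)    cs = code a (8 ∷ cs)

run : List ℕ → List Fm → List Fm
run (0 ∷ p ∷ cs) st           = run cs (var p ∷ st)
run (1 ∷ cs)     st           = run cs (bot ∷ st)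
run (2 ∷ cs)     st           = run cs (top ∷ st)
run (3 ∷ cs)     (a ∷ st)     = run cs (neg a ∷ st)
run (4 ∷ cs)     (b ∷ a ∷ st) = run cs (conj a b ∷ st)
run (5 ∷ cs)     (b ∷ a ∷ st) = run cs (disj a b ∷ st)
run (6 ∷ cs)     (b ∷ a ∷ st) = run cs (imp a b ∷ st)
run (7 ∷ cs)     (a ∷ st)     = run cs (box a ∷ st)
run (8 ∷ cs)     (a ∷ st)     = run cs (dia a ∷ st)
run _            st           = st

run-code : ∀ a cs st → run (code a cs) st ≡ run cs (a ∷ st)
run-code (var p)    cs st = refl
run-code bot        cs st = refl
run-code top        cs st = refl
run-code (neg a)    cs st = run-code a _ st
run-code (conj a b) cs st = trans (run-code a _ st) (run-code b _ (a ∷ st))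
run-code (disj a b) cs st = trans (run-code a _ st) (run-code b _ (a ∷ st))
run-code (imp a b)  cs st = trans (run-code a _ st) (run-code b _ (a ∷ st))
run-code (box a)    cs st = run-code a _ st
run-code (dia a)    cs st = run-code a _ st

code-injective : ∀ {a b} → code a [] ≡ code b [] → a ≡ b
code-injective {a} {b} eq = ∷-injectiveˡ (begin
  a ∷ []             ≡⟨ run-code a [] [] ⟨
  run (code a []) [] ≡⟨ cong (λ cs → run cs []) eq ⟩
  run (code b []) [] ≡⟨ run-code b [] [] ⟩
  b ∷ []             ∎)
  where open ≡-Reasoning

_≟_ : DecidableEquality Fm
a ≟ b = map′ code-injective (cong (λ c → code c [])) (≡-dec ℕ._≟_ (code a []) (code b []))

open import Data.List.Membership.DecPropositional _≟_ using (_∈?_)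
open import Data.List.Relation.Binary.Subset.DecPropositional _≟_ using (_⊆?_)

⊩-stable : ∀ M w a → ¬ ¬ (M , w ⊩ a) → M , w ⊩ a
⊩-stable M w (var p) h with Val M p w Bool.≟ true
... | yes v = v
... | no ¬v = ⊥-elim (h ¬v)
⊩-stable M w bot h = h (λ z → z)
⊩-stable M w top h = tt
⊩-stable M w (neg a) h = λ x → h (λ ¬x → ¬x x)
⊩-stable M w (conj a b) h =
  ⊩-stable M w a (λ ¬x → h (¬x ∘ proj₁)) , ⊩-stable M w b (λ ¬y → h (¬y ∘ proj₂))
⊩-stable M w (disj a b) h = λ x → h (λ ¬x → ¬x x)
⊩-stable M w (imp a b) h = λ x → ⊩-stable M w b (λ ¬y → h (λ f → ¬y (f x)))
⊩-stable M w (box a) h = λ v r → ⊩-stable M v a (λ ¬x → h (λ f → ¬x (f v r)))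
⊩-stable M w (dia a) h = λ x → h (λ ¬x → ¬x x)

mutual
  nnf-sound : ∀ M w a → M , w ⊩ nnf a → M , w ⊩ a
  nnf-sound M w (var p) h = h
  nnf-sound M w bot h = h
  nnf-sound M w top h = h
  nnf-sound M w (neg a) h = nnfNeg-sound M w a h
  nnf-sound M w (conj a b) (x , y) = nnf-sound M w a x , nnf-sound M w b y
  nnf-sound M w (disj a b) h (¬x , ¬y) = h (¬x ∘ nnf-sound M w a , ¬y ∘ nnf-sound M w b)
  nnf-sound M w (imp a b) h x = ⊩-stable M w b λ ¬y →
    h ((λ n → nnfNeg-sound M w a n x) , ¬y ∘ nnf-sound M w b)
  nnf-sound M w (box a) h v r = nnf-sound M v a (h v r)
  nnf-sound M w (dia a) h ¬◇ = h (λ v r → ¬◇ v r ∘ nnf-sound M v a)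

  nnfNeg-sound : ∀ M w a → M , w ⊩ nnfNeg a → ¬ (M , w ⊩ a)
  nnfNeg-sound M w (var p) h = h
  nnfNeg-sound M w bot h = λ z → z
  nnfNeg-sound M w top h = λ _ → h
  nnfNeg-sound M w (neg a) h = λ ¬x → ¬x (nnf-sound M w a h)
  nnfNeg-sound M w (conj a b) h (x , y) =
    h ((λ n → nnfNeg-sound M w a n x) , (λ n → nnfNeg-sound M w b n y))
  nnfNeg-sound M w (disj a b) (x , y) h = h (nnfNeg-sound M w a x , nnfNeg-sound M w b y)
  nnfNeg-sound M w (imp a b) (x , y) f = nnfNeg-sound M w b y (f (nnf-sound M w a x))
  nnfNeg-sound M w (box a) h □ = h (λ v r n → nnfNeg-sound M v a n (□ v r))
  nnfNeg-sound M w (dia a) h ◇ = ◇ (λ v r → nnfNeg-sound M v a (h v r))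

⋁ : List Fm → Fm
⋁ = foldr disj bot

module _ {M : Model} {w : World M} where

  ⊩-⋀⁺ : ∀ {xs} → All (M , w ⊩_) xs → M , w ⊩ ⋀ xs
  ⊩-⋀⁺ []       = tt
  ⊩-⋀⁺ (h ∷ hs) = h , ⊩-⋀⁺ hs

  ⊩-⋀⁻ : ∀ xs → M , w ⊩ ⋀ xs → All (M , w ⊩_) xs
  ⊩-⋀⁻ []       _        = []
  ⊩-⋀⁻ (x ∷ xs) (h , hs) = h ∷ ⊩-⋀⁻ xs hs

  ⊩-⋀-⊇ : ∀ xs {ys} → (∀ {a} → a ∈ ys → a ∈ xs) → M , w ⊩ ⋀ xs → M , w ⊩ ⋀ ys
  ⊩-⋀-⊇ xs ys⊆xs h = ⊩-⋀⁺ (tabulate (lookup (⊩-⋀⁻ xs h) ∘ ys⊆xs))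

  ⊩-⋁⁺ : ∀ {xs a} → a ∈ xs → M , w ⊩ a → M , w ⊩ ⋁ xs
  ⊩-⋁⁺ (here refl) h (¬h , _)  = ¬h h
  ⊩-⋁⁺ (there m)   h (_ , ¬hs) = ¬hs (⊩-⋁⁺ m h)

  ⊩-⋁⁻ : ∀ xs → M , w ⊩ ⋁ xs → ¬ All (λ a → ¬ (M , w ⊩ a)) xs
  ⊩-⋁⁻ []       h []         = h
  ⊩-⋁⁻ (x ∷ xs) h (¬h ∷ ¬hs) = h (¬h , λ hs → ⊩-⋁⁻ xs hs ¬hs)

module _ {A : Set} where

  sublists : List A → List (List A)
  sublists []       = [] ∷ []
  sublists (x ∷ xs) = map (x ∷_) (sublists xs) ++ sublists xs

  sublists-⊆ : ∀ {ys} xs → ys ∈ sublists xs → ∀ {a} → a ∈ ys → a ∈ xs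
  sublists-⊆ []       (here refl) ()
  sublists-⊆ (x ∷ xs) m a∈ with ∈-++⁻ (map (x ∷_) (sublists xs)) m
  ... | inj₂ m′ = there (sublists-⊆ xs m′ a∈)
  ... | inj₁ m′ with ∈-map⁻ (x ∷_) m′
  ...   | zs , zs∈ , refl with a∈
  ...     | here a≡x = here a≡x
  ...     | there a∈zs = there (sublists-⊆ xs zs∈ a∈zs)

  ¬¬-filter : (P : A → Set) (xs : List A) → ¬ ¬ Σ (List A) λ ys → ys ∈ sublists xs
    × All P ys × (∀ {a} → a ∈ xs → P a → a ∈ ys)
  ¬¬-filter P [] k = k ([] , here refl , [] , (λ ()))
  ¬¬-filter P (x ∷ xs) k = ¬¬-filter P xs λ (ys , m , sound , complete) → ¬¬-excluded-middle λ
    { (yes px) → k (x ∷ ys , ∈-++⁺ˡ (∈-map⁺ (x ∷_) m)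
                   , px ∷ sound
                   , (λ { (here refl) _ → here refl ; (there a∈) pa → there (complete a∈ pa) }))
    ; (no ¬px) → k (ys , ∈-++⁺ʳ _ m , sound
                   , (λ { (here refl) pa → ⊥-elim (¬px pa) ; (there a∈) pa → complete a∈ pa })) }

module _ {A B : Set} {P : A → Set} (P? : ∀ c → Dec (P c)) (f : ∀ c → P c → B) where

  mapFilter : List A → List B
  mapFilter []       = []
  mapFilter (c ∷ cs) with P? c
  ... | yes pc = f c pc ∷ mapFilter cs
  ... | no _   = mapFilter cs

  ∈-mapFilter⁺ : ∀ {c cs} → c ∈ cs → P c → Σ (P c) λ pc → f c pc ∈ mapFilter cs
  ∈-mapFilter⁺ {c} {c ∷ cs} (here refl) pc with P? c
  ... | yes pc′ = pc′ , here refl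
  ... | no ¬pc  = ⊥-elim (¬pc pc)
  ∈-mapFilter⁺ {c} {c′ ∷ cs} (there m) pc with P? c′
  ... | yes _ = let (pc′ , m′) = ∈-mapFilter⁺ m pc in pc′ , there m′
  ... | no _  = ∈-mapFilter⁺ m pc

  All-mapFilter : ∀ {Q : B → Set} → (∀ c pc → Q (f c pc)) → ∀ cs → All Q (mapFilter cs)
  All-mapFilter q []       = []
  All-mapFilter q (c ∷ cs) with P? c
  ... | yes pc = q c pc ∷ All-mapFilter q cs
  ... | no _   = All-mapFilter q cs

subf-self : ∀ a → a ∈ subf a
subf-self (var _)    = here refl
subf-self bot        = here refl
subf-self top        = here refl
subf-self (neg _)    = here refl
subf-self (conj _ _) = here refl
subf-self (disj _ _) = here refl
subf-self (imp _ _)  = here refl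
subf-self (box _)    = here refl
subf-self (dia _)    = here refl

subf-trans : ∀ χ {a b} → a ∈ subf χ → b ∈ subf a → b ∈ subf χ

subf-trans-++ : ∀ c d {a b} → a ∈ subf c ++ subf d → b ∈ subf a → b ∈ subf c ++ subf d
subf-trans-++ c d m n with ∈-++⁻ (subf c) m
... | inj₁ m′ = ∈-++⁺ˡ (subf-trans c m′ n)
... | inj₂ m′ = ∈-++⁺ʳ (subf c) (subf-trans d m′ n)

subf-trans (var _)    (here refl) n = n
subf-trans bot        (here refl) n = n
subf-trans top        (here refl) n = n
subf-trans (neg _)    (here refl) n = n
subf-trans (conj _ _) (here refl) n = n
subf-trans (conj c d) (there m)   n = there (subf-trans-++ c d m n)
subf-trans (disj _ _) (here refl) n = n
subf-trans (disj c d) (there m)   n = there (subf-trans-++ c d m n)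
subf-trans (imp _ _)  (here refl) n = n
subf-trans (imp c d)  (there m)   n = there (subf-trans-++ c d m n)
subf-trans (box _)    (here refl) n = n
subf-trans (box c)    (there m)   n = there (subf-trans c m n)
subf-trans (dia _)    (here refl) n = n
subf-trans (dia c)    (there m)   n = there (subf-trans c m n)

module _ (χ : Fm) {a : Fm} where

  subf-conjˡ : ∀ {b} → conj a b ∈ subf χ → a ∈ subf χ
  subf-conjˡ m = subf-trans χ m (there (∈-++⁺ˡ (subf-self a)))

  subf-conjʳ : ∀ {b} → conj a b ∈ subf χ → b ∈ subf χ
  subf-conjʳ {b} m = subf-trans χ m (there (∈-++⁺ʳ (subf a) (subf-self b)))

  subf-disjˡ : ∀ {b} → disj a b ∈ subf χ → a ∈ subf χ
  subf-disjˡ m = subf-trans χ m (there (∈-++⁺ˡ (subf-self a)))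

  subf-disjʳ : ∀ {b} → disj a b ∈ subf χ → b ∈ subf χ
  subf-disjʳ {b} m = subf-trans χ m (there (∈-++⁺ʳ (subf a) (subf-self b)))

  subf-box : box a ∈ subf χ → a ∈ subf χ
  subf-box m = subf-trans χ m (there (subf-self a))

  subf-dia : dia a ∈ subf χ → a ∈ subf χ
  subf-dia m = subf-trans χ m (there (subf-self a))

module _ {M : Model} {v : World M} {χ : Fm} {ys : List Fm}
         (ys⊆ : ∀ {a} → a ∈ ys → a ∈ subf χ) (sound : All (M , v ⊩_) ys)
         (complete : ∀ {a} → a ∈ subf χ → M , v ⊩ a → a ∈ ys) where

  truths-locCons : LocCons χ ys
  truths-locCons = record
    { sub     = tabulate ys⊆
    ; conjCl  = λ a b m → let (x , y) = lookup sound m in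
                  complete (subf-conjˡ χ (ys⊆ m)) x , complete (subf-conjʳ χ (ys⊆ m)) y
    ; disjCl  = disjCl
    ; noBot   = lookup sound
    ; noClash = λ p (x , ¬x) → lookup sound ¬x (lookup sound x)
    }
    where
    disjCl : ∀ a b → disj a b ∈ ys → a ∈ ys ⊎ b ∈ ys
    disjCl a b m with a ∈? ys | b ∈? ys
    ... | yes a∈ | _      = inj₁ a∈
    ... | no _   | yes b∈ = inj₂ b∈
    ... | no a∉  | no b∉  = ⊥-elim (lookup sound m
      ( a∉ ∘ complete (subf-disjˡ χ (ys⊆ m))
      , b∉ ∘ complete (subf-disjʳ χ (ys⊆ m))))

record Realized (M : Model) (v : World M) (χ : Fm) : Set where
  field
    type      : List Fm
    candidate : type ∈ sublists (subf χ)
    locCons   : LocCons χ type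
    holds     : All (M , v ⊩_) type
    complete  : ∀ {a} → a ∈ subf χ → M , v ⊩ a → a ∈ type

-- Truth at v is not decidable, so the type of v exists only up to ¬¬; this suffices
-- because every goal it is used for is a negation.
realized : ∀ M v χ → ¬ ¬ Realized M v χ
realized M v χ k = ¬¬-filter (M , v ⊩_) (subf χ) λ (ys , ys∈ , sound , complete) →
  k record
    { type      = ys
    ; candidate = ys∈
    ; locCons   = truths-locCons (sublists-⊆ (subf χ) ys∈) sound complete
    ; holds     = sound
    ; complete  = complete
    }

_⇒ᶜ_ : List Fm → List Fm → Set
X ⇒ᶜ Y = ∀ a → box a ∈ X → a ∈ Y

realized-⇒ᶜ : ∀ {M w v χ X} → All (_∈ subf χ) X → M , w ⊩ ⋀ X → Acc M w v →
              (r : Realized M v χ) → X ⇒ᶜ Realized.type r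
realized-⇒ᶜ {χ = χ} {X} X⊆ hX wRv r a m =
  Realized.complete r (subf-box χ (lookup X⊆ m)) (lookup (⊩-⋀⁻ X hX) m _ wRv)

-- The condition that local consistency of X imposes on a single member of X.
Closed : List Fm → Fm → Set
Closed X (var p)    = neg (var p) ∉ X
Closed X bot        = ⊥
Closed X (conj a b) = a ∈ X × b ∈ X
Closed X (disj a b) = a ∈ X ⊎ b ∈ X
Closed X _          = ⊤

closed? : ∀ X a → Dec (Closed X a)
closed? X (var p)    = ¬? (neg (var p) ∈? X)
closed? X bot        = no λ ()
closed? X top        = yes tt
closed? X (neg _)    = yes tt
closed? X (conj a b) = a ∈? X ×-dec b ∈? X
closed? X (disj a b) = a ∈? X ⊎-dec b ∈? X
closed? X (imp _ _)  = yes tt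
closed? X (box _)    = yes tt
closed? X (dia _)    = yes tt

locCons-closed : ∀ {χ X} → LocCons χ X → All (Closed X) X
locCons-closed {X = X} lc = tabulate closed
  where
  open LocCons lc
  closed : ∀ {a} → a ∈ X → Closed X a
  closed {var p}    m = λ ¬p → noClash p (m , ¬p)
  closed {bot}      m = noBot m
  closed {top}      m = tt
  closed {neg _}    m = tt
  closed {conj a b} m = conjCl a b m
  closed {disj a b} m = disjCl a b m
  closed {imp _ _}  m = tt
  closed {box _}    m = tt
  closed {dia _}    m = tt

locCons? : ∀ χ X → Dec (LocCons χ X)
locCons? χ X = map′ fromAll (λ lc → LocCons.sub lc , locCons-closed lc)
  (all? (_∈? subf χ) X ×-dec all? (closed? X) X)
  where
  fromAll : All (_∈ subf χ) X × All (Closed X) X → LocCons χ X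
  fromAll (sub , closed) = record
    { sub     = sub
    ; conjCl  = λ a b m → lookup closed m
    ; disjCl  = λ a b m → lookup closed m
    ; noBot   = lookup closed
    ; noClash = λ p (x , ¬x) → lookup closed x ¬x
    }

-- The quantifier over a is bounded: box a ∈ X puts a in concatMap subf X.
_⇒ᶜ?_ : ∀ X Y → Dec (X ⇒ᶜ Y)
X ⇒ᶜ? Y = map′ (λ h a m → lookup h (∈-concat⁺′ (there (subf-self a)) (∈-map⁺ subf m)) m)
                (λ h → tabulate λ {a} _ → h a)
                (all? (λ a → box a ∈? X →-dec a ∈? Y) (concatMap subf X))

_⇒ᵀ?_ : ∀ τ σ → Dec (τ ⇒ᵀ σ)
τ ⇒ᵀ? σ = map′ (λ (l , r) → λ { L → l ; R → r }) (λ h → h L , h R)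
               (proj₁ τ ⇒ᶜ? proj₁ σ ×-dec proj₂ τ ⇒ᶜ? proj₂ σ)

_≈ᵀ?_ : ∀ σ τ → Dec (σ ≈ᵀ τ)
σ ≈ᵀ? τ = map′ (λ (l , r) → λ { L → l ; R → r }) (λ e → e L , e R)
               (sameSet? L ×-dec sameSet? R)
  where
  SameSet : Side → Set
  SameSet D = ∀ a → (a ∈ comp D σ → a ∈ comp D τ) × (a ∈ comp D τ → a ∈ comp D σ)
  sameSet? : ∀ D → Dec (SameSet D)
  sameSet? D with comp D σ ⊆? comp D τ | comp D τ ⊆? comp D σ
  ... | yes l | yes r = yes λ a → l , r
  ... | no ¬l | _     = no λ e → ¬l (proj₁ (e _))
  ... | _     | no ¬r = no λ e → ¬r (proj₂ (e _))

_≼_ : Fm → Fm → Set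
a ≼ b = (∀ {p} → Pos p a → Pos p b) × (∀ {p} → Neg p a → Neg p b)

≼-refl : ∀ {a} → a ≼ a
≼-refl = (λ x → x) , (λ x → x)

≼-trans : ∀ {a b c} → a ≼ b → b ≼ c → a ≼ c
≼-trans (pab , nab) (pbc , nbc) = pbc ∘ pab , nbc ∘ nab

≼-neg : ∀ {a b} → a ≼ b → neg a ≼ neg b
≼-neg (pa , na) = (λ { (pneg x) → pneg (na x) }) , (λ { (nneg x) → nneg (pa x) })

≼-neg-swap : ∀ {a b} → a ≼ neg b → neg a ≼ b
≼-neg-swap (pa , na) = (λ { (pneg x) → nneg⁻¹ (na x) }) , (λ { (nneg x) → pneg⁻¹ (pa x) })
  where
  nneg⁻¹ : ∀ {p b} → Neg p (neg b) → Pos p b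
  nneg⁻¹ (nneg x) = x
  pneg⁻¹ : ∀ {p b} → Pos p (neg b) → Neg p b
  pneg⁻¹ (pneg x) = x

≼-conj : ∀ {a b c} → a ≼ c → b ≼ c → conj a b ≼ c
≼-conj (pa , na) (pb , nb) = (λ { (pconjˡ x) → pa x ; (pconjʳ x) → pb x })
                           , (λ { (nconjˡ x) → na x ; (nconjʳ x) → nb x })

≼-disj : ∀ {a b c} → a ≼ c → b ≼ c → disj a b ≼ c
≼-disj (pa , na) (pb , nb) = (λ { (pdisjˡ x) → pa x ; (pdisjʳ x) → pb x })
                           , (λ { (ndisjˡ x) → na x ; (ndisjʳ x) → nb x })

≼-dia : ∀ {a c} → a ≼ c → dia a ≼ c
≼-dia (pa , na) = (λ { (pdia x) → pa x }) , (λ { (ndia x) → na x })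

≼-top : ∀ {c} → top ≼ c
≼-top = (λ ()) , (λ ())

≼-bot : ∀ {c} → bot ≼ c
≼-bot = (λ ()) , (λ ())

≼-⋀ : ∀ {xs c} → All (_≼ c) xs → ⋀ xs ≼ c
≼-⋀ []       = ≼-top
≼-⋀ (h ∷ hs) = ≼-conj h (≼-⋀ hs)

≼-⋁ : ∀ {xs c} → All (_≼ c) xs → ⋁ xs ≼ c
≼-⋁ []       = ≼-bot
≼-⋁ (h ∷ hs) = ≼-disj h (≼-⋁ hs)

ImpFree : Fm → Set
ImpFree (neg a)    = ImpFree a
ImpFree (conj a b) = ImpFree a × ImpFree b
ImpFree (disj a b) = ImpFree a × ImpFree b
ImpFree (imp _ _)  = ⊥
ImpFree (box a)    = ImpFree a
ImpFree (dia a)    = ImpFree a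
ImpFree _          = ⊤

mutual
  nnf-impFree : ∀ a → ImpFree (nnf a)
  nnf-impFree (var _)    = tt
  nnf-impFree bot        = tt
  nnf-impFree top        = tt
  nnf-impFree (neg a)    = nnfNeg-impFree a
  nnf-impFree (conj a b) = nnf-impFree a , nnf-impFree b
  nnf-impFree (disj a b) = nnf-impFree a , nnf-impFree b
  nnf-impFree (imp a b)  = nnfNeg-impFree a , nnf-impFree b
  nnf-impFree (box a)    = nnf-impFree a
  nnf-impFree (dia a)    = nnf-impFree a

  nnfNeg-impFree : ∀ a → ImpFree (nnfNeg a)
  nnfNeg-impFree (var _)    = tt
  nnfNeg-impFree bot        = tt
  nnfNeg-impFree top        = tt
  nnfNeg-impFree (neg a)    = nnf-impFree a
  nnfNeg-impFree (conj a b) = nnfNeg-impFree a , nnfNeg-impFree b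
  nnfNeg-impFree (disj a b) = nnfNeg-impFree a , nnfNeg-impFree b
  nnfNeg-impFree (imp a b)  = nnf-impFree a , nnfNeg-impFree b
  nnfNeg-impFree (box a)    = nnfNeg-impFree a
  nnfNeg-impFree (dia a)    = nnfNeg-impFree a

-- subf descends neither through negations nor, given ImpFree, through implications,
-- the only connectives that flip polarity.
subf-≼ : ∀ χ → ImpFree χ → ∀ {a} → a ∈ subf χ → a ≼ χ
subf-≼ (var _)    _        (here refl) = ≼-refl
subf-≼ bot        _        (here refl) = ≼-refl
subf-≼ top        _        (here refl) = ≼-refl
subf-≼ (neg _)    _        (here refl) = ≼-refl
subf-≼ (conj _ _) _        (here refl) = ≼-refl
subf-≼ (conj c d) (fc , fd) (there m) with ∈-++⁻ (subf c) m
... | inj₁ m′ = ≼-trans (subf-≼ c fc m′) (pconjˡ , nconjˡ)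
... | inj₂ m′ = ≼-trans (subf-≼ d fd m′) (pconjʳ , nconjʳ)
subf-≼ (disj _ _) _        (here refl) = ≼-refl
subf-≼ (disj c d) (fc , fd) (there m) with ∈-++⁻ (subf c) m
... | inj₁ m′ = ≼-trans (subf-≼ c fc m′) (pdisjˡ , ndisjˡ)
... | inj₂ m′ = ≼-trans (subf-≼ d fd m′) (pdisjʳ , ndisjʳ)
subf-≼ (box _)    _        (here refl) = ≼-refl
subf-≼ (box c)    fc       (there m)   = ≼-trans (subf-≼ c fc m) (pbox , nbox)
subf-≼ (dia _)    _        (here refl) = ≼-refl
subf-≼ (dia c)    fc       (there m)   = ≼-trans (subf-≼ c fc m) (pdia , ndia)

mutual
  nnf-pos : ∀ {p} a → Pos p (nnf a) → Pos p a
  nnf-pos (var _)    pvar       = pvar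
  nnf-pos (neg a)    x          = pneg (nnfNeg-pos a x)
  nnf-pos (conj a b) (pconjˡ x) = pconjˡ (nnf-pos a x)
  nnf-pos (conj a b) (pconjʳ x) = pconjʳ (nnf-pos b x)
  nnf-pos (disj a b) (pdisjˡ x) = pdisjˡ (nnf-pos a x)
  nnf-pos (disj a b) (pdisjʳ x) = pdisjʳ (nnf-pos b x)
  nnf-pos (imp a b)  (pdisjˡ x) = pimpˡ (nnfNeg-pos a x)
  nnf-pos (imp a b)  (pdisjʳ x) = pimpʳ (nnf-pos b x)
  nnf-pos (box a)    (pbox x)   = pbox (nnf-pos a x)
  nnf-pos (dia a)    (pdia x)   = pdia (nnf-pos a x)

  nnf-neg : ∀ {p} a → Neg p (nnf a) → Neg p a
  nnf-neg (neg a)    x          = nneg (nnfNeg-neg a x)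
  nnf-neg (conj a b) (nconjˡ x) = nconjˡ (nnf-neg a x)
  nnf-neg (conj a b) (nconjʳ x) = nconjʳ (nnf-neg b x)
  nnf-neg (disj a b) (ndisjˡ x) = ndisjˡ (nnf-neg a x)
  nnf-neg (disj a b) (ndisjʳ x) = ndisjʳ (nnf-neg b x)
  nnf-neg (imp a b)  (ndisjˡ x) = nimpˡ (nnfNeg-neg a x)
  nnf-neg (imp a b)  (ndisjʳ x) = nimpʳ (nnf-neg b x)
  nnf-neg (box a)    (nbox x)   = nbox (nnf-neg a x)
  nnf-neg (dia a)    (ndia x)   = ndia (nnf-neg a x)

  nnfNeg-pos : ∀ {p} a → Pos p (nnfNeg a) → Neg p a
  nnfNeg-pos (var _)    (pneg ())
  nnfNeg-pos (neg a)    x          = nneg (nnf-pos a x)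
  nnfNeg-pos (conj a b) (pdisjˡ x) = nconjˡ (nnfNeg-pos a x)
  nnfNeg-pos (conj a b) (pdisjʳ x) = nconjʳ (nnfNeg-pos b x)
  nnfNeg-pos (disj a b) (pconjˡ x) = ndisjˡ (nnfNeg-pos a x)
  nnfNeg-pos (disj a b) (pconjʳ x) = ndisjʳ (nnfNeg-pos b x)
  nnfNeg-pos (imp a b)  (pconjˡ x) = nimpˡ (nnf-pos a x)
  nnfNeg-pos (imp a b)  (pconjʳ x) = nimpʳ (nnfNeg-pos b x)
  nnfNeg-pos (box a)    (pdia x)   = nbox (nnfNeg-pos a x)
  nnfNeg-pos (dia a)    (pbox x)   = ndia (nnfNeg-pos a x)

  nnfNeg-neg : ∀ {p} a → Neg p (nnfNeg a) → Pos p a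
  nnfNeg-neg (var _)    (nneg pvar) = pvar
  nnfNeg-neg (neg a)    x          = pneg (nnf-neg a x)
  nnfNeg-neg (conj a b) (ndisjˡ x) = pconjˡ (nnfNeg-neg a x)
  nnfNeg-neg (conj a b) (ndisjʳ x) = pconjʳ (nnfNeg-neg b x)
  nnfNeg-neg (disj a b) (nconjˡ x) = pdisjˡ (nnfNeg-neg a x)
  nnfNeg-neg (disj a b) (nconjʳ x) = pdisjʳ (nnfNeg-neg b x)
  nnfNeg-neg (imp a b)  (nconjˡ x) = pimpˡ (nnf-neg a x)
  nnfNeg-neg (imp a b)  (nconjʳ x) = pimpʳ (nnfNeg-neg b x)
  nnfNeg-neg (box a)    (ndia x)   = pbox (nnfNeg-neg a x)
  nnfNeg-neg (dia a)    (nbox x)   = pdia (nnfNeg-neg a x)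

nnf-≼ : ∀ a → nnf a ≼ a
nnf-≼ a = nnf-pos a , nnf-neg a

nnfNeg-≼ : ∀ a → nnfNeg a ≼ neg a
nnfNeg-≼ a = pneg ∘ nnfNeg-pos a , nneg ∘ nnfNeg-neg a

subf-nnf-≼ : ∀ χ {a} → a ∈ subf (nnf χ) → a ≼ χ
subf-nnf-≼ χ m = ≼-trans (subf-≼ (nnf χ) (nnf-impFree χ) m) (nnf-≼ χ)

record Interpolant (φ ψ : Fm) (τ : Ty) : Set₁ where
  field
    formula    : Fm
    entailed   : ⊨ imp (⋀ (proj₁ τ)) formula
    refutes    : ⊨ imp formula (neg (⋀ (proj₂ τ)))
    polarity-φ : formula ≼ φ
    polarity-ψ : formula ≼ ψ

InterpolatesOutside : Fm → Fm → TySet → Set₁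
InterpolatesOutside φ ψ Y = ∀ σ → IsType φ ψ σ → ¬ Y σ → Interpolant φ ψ σ

interpolant-resp-≈ : ∀ {φ ψ σ τ} → σ ≈ᵀ τ → Interpolant φ ψ τ → Interpolant φ ψ σ
interpolant-resp-≈ {σ = σ} σ≈τ I = record
  { formula    = formula
  ; entailed   = λ M w hσ → entailed M w (⊩-⋀-⊇ (proj₁ σ) (proj₂ (σ≈τ L _)) hσ)
  ; refutes    = λ M w h hσ → refutes M w h (⊩-⋀-⊇ (proj₂ σ) (proj₂ (σ≈τ R _)) hσ)
  ; polarity-φ = polarity-φ
  ; polarity-ψ = polarity-ψ
  }
  where open Interpolant I

-- Exchanging the roles of (φ, τL) and (¬ψ, τR) turns an interpolant θ into ¬θ;
-- note nnf (neg (neg φ)) = nnf φ, so types for the swapped pair are swapped types.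
swap-interpolant : ∀ {φ ψ τ} → Interpolant φ ψ τ → Interpolant (neg ψ) (neg φ) (swap τ)
swap-interpolant I = record
  { formula    = neg formula
  ; entailed   = λ M w hR h → refutes M w h hR
  ; refutes    = λ M w ¬h hL → ¬h (entailed M w hL)
  ; polarity-φ = ≼-neg polarity-ψ
  ; polarity-ψ = ≼-neg polarity-φ
  }
  where open Interpolant I

unswap-interpolant : ∀ {φ ψ τ} → Interpolant (neg ψ) (neg φ) (swap τ) → Interpolant φ ψ τ
unswap-interpolant I = record
  { formula    = neg formula
  ; entailed   = λ M w hL h → refutes M w h hL
  ; refutes    = λ M w ¬h hR → ¬h (entailed M w hR)
  ; polarity-φ = ≼-neg-swap polarity-ψ
  ; polarity-ψ = ≼-neg-swap polarity-φ
  }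
  where open Interpolant I

-- nnfNeg maps p to ¬p and ¬p to p, so this g is the clashing literal of τR.
overlap-witness : ∀ τ → ¬ OverlapCons τ → Σ Fm λ g → g ∈ proj₂ τ × nnfNeg g ∈ proj₁ τ
overlap-witness (τL , τR) ¬oc with any? (λ g → nnfNeg g ∈? τL) τR
... | yes clash = find clash
... | no ¬clash = ⊥-elim (¬oc λ p → (λ (x , y) → ¬clash (lose y x))
                                  , (λ (x , y) → ¬clash (lose y x)))

interpolant-clash : ∀ {φ ψ τ g} → IsType φ ψ τ → g ∈ proj₂ τ → nnfNeg g ∈ proj₁ τ →
                    Interpolant φ ψ τ
interpolant-clash {φ} {ψ} {τ} {g} (tL , tR) g∈ ¬g∈ = record
  { formula    = nnfNeg g
  ; entailed   = λ M w hL → lookup (⊩-⋀⁻ (proj₁ τ) hL) ¬g∈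
  ; refutes    = λ M w h hR → nnfNeg-sound M w g h (lookup (⊩-⋀⁻ (proj₂ τ) hR) g∈)
  ; polarity-φ = subf-nnf-≼ φ (lookup (LocCons.sub tL) ¬g∈)
  ; polarity-ψ = ≼-trans (nnfNeg-≼ g)
                   (≼-neg-swap (subf-nnf-≼ (neg ψ) (lookup (LocCons.sub tR) g∈)))
  }

module Diamond {φ ψ Y} (ih : InterpolatesOutside φ ψ Y) {τ : Ty} (tτ : IsType φ ψ τ)
               {χ : Fm} (◇χ : dia χ ∈ proj₁ τ)
               (unwitnessed : ¬ Σ Ty λ τ′ → Y τ′ × τ ⇒ᵀ τ′ × χ ∈ proj₁ τ′) where

  Successor : Ty → Set
  Successor σ = IsType φ ψ σ × τ ⇒ᵀ σ × χ ∈ proj₁ σ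

  successor? : ∀ σ → Dec (Successor σ)
  successor? σ = (locCons? (nnf φ) (proj₁ σ) ×-dec locCons? (nnf (neg ψ)) (proj₂ σ))
                 ×-dec τ ⇒ᵀ? σ ×-dec χ ∈? proj₁ σ

  successor-interpolant : ∀ σ → Successor σ → Interpolant φ ψ σ
  successor-interpolant σ (tσ , s) = ih σ tσ λ y → unwitnessed (σ , y , s)

  SuccessorL : List Fm → Set
  SuccessorL σL = LocCons (nnf φ) σL × proj₁ τ ⇒ᶜ σL × χ ∈ σL

  successorL? : ∀ σL → Dec (SuccessorL σL)
  successorL? σL = locCons? (nnf φ) σL ×-dec proj₁ τ ⇒ᶜ? σL ×-dec χ ∈? σL

  θ : ∀ σL ρ → Successor (σL , ρ) → Fm
  θ σL ρ s = Interpolant.formula (successor-interpolant (σL , ρ) s)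

  candidatesL candidatesR : List (List Fm)
  candidatesL = sublists (subf (nnf φ))
  candidatesR = sublists (subf (nnf (neg ψ)))

  successor-interpolants : List Fm → List Fm
  successor-interpolants σL = mapFilter (λ ρ → successor? (σL , ρ)) (θ σL) candidatesR

  column : ∀ σL → SuccessorL σL → Fm
  column σL _ = ⋀ (successor-interpolants σL)

  columns : List Fm
  columns = mapFilter successorL? column candidatesL

  module _ {Q : Fm → Set} where

    All-successor-interpolants : ∀ σL → (∀ ρ s → Q (θ σL ρ s)) →
                                 All Q (successor-interpolants σL)
    All-successor-interpolants σL q =
      All-mapFilter (λ ρ → successor? (σL , ρ)) (θ σL) q candidatesR

    All-columns : (∀ σL sL → Q (column σL sL)) → All Q columns
    All-columns q = All-mapFilter successorL? column q candidatesL

  entailed : ⊨ imp (⋀ (proj₁ τ)) (dia (⋁ columns))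
  entailed M w hL none = lookup (⊩-⋀⁻ (proj₁ τ) hL) ◇χ λ v wRv hχ →
    realized M v (nnf φ) λ r →
    let open Realized r
        sL : SuccessorL type
        sL = locCons , realized-⇒ᶜ (LocCons.sub (proj₁ tτ)) hL wRv r
           , complete (subf-dia _ (lookup (LocCons.sub (proj₁ tτ)) ◇χ)) hχ
    in none v wRv (⊩-⋁⁺ (proj₂ (∈-mapFilter⁺ successorL? column candidate sL))
         (⊩-⋀⁺ (All-successor-interpolants type λ ρ s →
           Interpolant.entailed (successor-interpolant _ s) M v (⊩-⋀⁺ holds))))

  refutes : ⊨ imp (dia (⋁ columns)) (neg (⋀ (proj₂ τ)))
  refutes M w h◇ hR = h◇ λ v wRv h → ⊩-⋁⁻ columns h (All-columns λ σL sL hcol →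
    realized M v (nnf (neg ψ)) λ r →
      let open Realized r
          s : Successor (σL , type)
          s = (proj₁ sL , locCons)
            , (λ { L → proj₁ (proj₂ sL) ; R → realized-⇒ᶜ (LocCons.sub (proj₂ tτ)) hR wRv r })
            , proj₂ (proj₂ sL)
          (s′ , m) = ∈-mapFilter⁺ (λ ρ → successor? (σL , ρ)) (θ σL) candidate s
      in Interpolant.refutes (successor-interpolant _ s′) M v
           (lookup (⊩-⋀⁻ _ hcol) m) (⊩-⋀⁺ holds))

  interpolant : Interpolant φ ψ τ
  interpolant = record
    { formula    = dia (⋁ columns)
    ; entailed   = entailed
    ; refutes    = refutes
    ; polarity-φ = ≼-dia (≼-⋁ (All-columns λ σL _ → ≼-⋀ (All-successor-interpolants σL
                     λ ρ s → Interpolant.polarity-φ (successor-interpolant _ s))))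
    ; polarity-ψ = ≼-dia (≼-⋁ (All-columns λ σL _ → ≼-⋀ (All-successor-interpolants σL
                     λ ρ s → Interpolant.polarity-ψ (successor-interpolant _ s))))
    }

module _ {φ ψ Y} (ih : InterpolatesOutside φ ψ Y) {τ : Ty} (tτ : IsType φ ψ τ) where

  interpolant-violation : Violates Y τ → Interpolant φ ψ τ
  interpolant-violation (inj₁ ¬oc) =
    let (g , g∈ , ¬g∈) = overlap-witness τ ¬oc in interpolant-clash tτ g∈ ¬g∈
  interpolant-violation (inj₂ (L , χ , ◇χ , unwitnessed)) = Diamond.interpolant ih tτ ◇χ unwitnessed
  interpolant-violation (inj₂ (R , χ , ◇χ , unwitnessed)) =
    unswap-interpolant (Diamond.interpolant swapped-ih (swap tτ) ◇χ
      λ (τ′ , y , τ⇒τ′ , χ∈) →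
        unwitnessed (swap τ′ , y , (λ { L → τ⇒τ′ R ; R → τ⇒τ′ L }) , χ∈))
    where
    swapped-ih : InterpolatesOutside (neg ψ) (neg φ) (Y ∘ swap)
    swapped-ih σ tσ σ∉ = swap-interpolant (ih (swap σ) (swap tσ) σ∉)

module _ {φ ψ} (S : ElimSeq φ ψ) where
  open ElimSeq S

  X-isType : ∀ i → i ≤ n → ∀ σ → X i σ → IsType φ ψ σ
  X-isType zero    _   σ σ∈ = proj₁ (start σ) σ∈
  X-isType (suc i) i<n σ σ∈ =
    let (_ , _ , _ , next) = step i i<n in X-isType i (<⇒≤ i<n) σ (proj₁ (proj₁ (next σ) σ∈))

  interpolates-outside : ∀ i → i ≤ n → InterpolatesOutside φ ψ (X i)
  interpolates-outside zero    _   σ tσ σ∉ = ⊥-elim (σ∉ (proj₂ (start σ) tσ))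
  interpolates-outside (suc i) i<n σ tσ σ∉ with step i i<n | interpolates-outside i (<⇒≤ i<n)
  ... | τ , τ∈ , violation , next | ih with σ ≈ᵀ? τ
  ...   | yes σ≈τ = interpolant-resp-≈ σ≈τ
                      (interpolant-violation ih (X-isType i (<⇒≤ i<n) τ τ∈) violation)
  ...   | no σ≉τ  = ih σ tσ λ σ∈ → σ∉ (proj₂ (next σ) (σ∈ , σ≉τ))

theorem44 : (φ ψ : Fm) → ⊨ imp φ ψ → (S : ElimSeq φ ψ) →
    (∀ τ → ElimSeq.X S (ElimSeq.n S) τ →
      ¬ ((nnf φ ∈ proj₁ τ) × (nnf (neg ψ) ∈ proj₂ τ))) →
    ∀ τ → ElimSeq.X S 0 τ → ¬ ElimSeq.X S (ElimSeq.n S) τ →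
    Σ Fm (λ θ → ⊨ imp (⋀ (proj₁ τ)) θ × ⊨ imp θ (neg (⋀ (proj₂ τ)))
      × (∀ p → Pos p θ → Pos p φ × Pos p ψ)
      × (∀ p → Neg p θ → Neg p φ × Neg p ψ))
theorem44 φ ψ _ S _ τ τ∈X₀ τ∉Xₙ =
  formula , entailed , refutes
  , (λ p x → proj₁ polarity-φ x , proj₁ polarity-ψ x)
  , (λ p x → proj₂ polarity-φ x , proj₂ polarity-ψ x)
  where
  open ElimSeq S
  open Interpolant (interpolates-outside S n ≤-refl τ (X-isType S 0 z≤n τ τ∈X₀) τ∉Xₙ)
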